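{- Let $m,n\in\mathbb{N}$ and $d\ge0$ an integer. If $\mathbf{x}\in\mathrm{DPF}^\uparrow_{m,n,d}$, then its conjugate $\bar{\mathbf{x}}$ lies in $\mathrm{DPF}^\uparrow_{n,m,d+(n-m)}$. Furthermore, the map $c:\mathrm{DPF}^\uparrow_{m,n,d}\to\mathrm{DPF}^\uparrow_{n,m,d+(n-m)}$, $c(\mathbf{x})=\bar{\mathbf{x}}$, is a bijection.
   Context: For $\mathbf{x}\in[n+1]^m$: cars $1,\ldots,m$ arrive in order at an infinitely long street with spots $1,2,3,\ldots$, car $i$ parking in the first empty spot numbered $\ge x_i$; the defect is the number of cars parking in a spot numbered greater than $n$. $\mathrm{DPF}^\uparrow_{m,n,d}$ is the set of nondecreasing $\mathbf{x}\in[n+1]^m$ with defect $d$ (similarly $\mathrm{DPF}^\uparrow_{n,m,e}$ with $n$ cars and $m$ spots). A nondecreasing $\mathbf{x}\in[n+1]^m$ corresponds to the lattice path $\mathbf{w}$ from $(0,0)$ to $(n,m)$, written as a word with $m$ letters $N$ (north steps) and $n$ letters $E$ (east steps), in which exactly $x_i-1$ letters $E$ precede the $i$-th $N$. The conjugate path $\bar{\mathbf{w}}$ is obtained by reversing the word $\mathbf{w}$ and then interchanging $N$ and $E$; it goes from $(0,0)$ to $(m,n)$. The conjugate $\bar{\mathbf{x}}\in[m+1]^n$ is the nondecreasing tuple corresponding to $\bar{\mathbf{w}}$, i.e. $\bar{x}_i-1$ is the number of $E$'s preceding the $i$-th $N$ of $\bar{\mathbf{w}}$. -}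

module Defs where

open import Data.Nat using (ℕ; zero; suc; _∸_; _≤_; _<?_; _≡ᵇ_)
open import Data.Bool using (Bool; true; false; if_then_else_)
open import Data.Bool.ListAction using (any)
open import Data.List using (List; []; _∷_; length; filter; reverse; map; replicate; _++_)
open import Data.List.Relation.Unary.All using (All)
open import Data.List.Relation.Unary.Linked using (Linked)
open import Data.Product using (_×_)
open import Relation.Binary.PropositionalEquality using (_≡_)

-- Parking on an infinitely long street with spots 1,2,3,...

-- First empty spot numbered ≥ a, given the list of occupied spots.
-- The fuel argument only ensures termination: with fuel 1 + (number of
-- occupied spots) the search always reaches an empty spot.
firstFreeFuel : List ℕ → ℕ → ℕ → ℕ
firstFreeFuel occ a zero    = a
firstFreeFuel occ a (suc f) =
  if any (λ b → a ≡ᵇ b) occ then firstFreeFuel occ (suc a) f else a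

firstFree : List ℕ → ℕ → ℕ
firstFree occ a = firstFreeFuel occ a (suc (length occ))

spotsFrom : List ℕ → List ℕ → List ℕ
spotsFrom occ []       = []
spotsFrom occ (a ∷ as) = firstFree occ a ∷ spotsFrom (firstFree occ a ∷ occ) as

spots : List ℕ → List ℕ
spots = spotsFrom []

defect : ℕ → List ℕ → ℕ
defect n x = length (filter (λ s → n <? s) (spots x))

InRange : ℕ → ℕ → Set
InRange n a = 1 ≤ a × a ≤ suc n

DPF↑ : ℕ → ℕ → ℕ → List ℕ → Set
DPF↑ m n d x = length x ≡ m × All (InRange n) x × Linked _≤_ x × defect n x ≡ d

data Step : Set where
  N E : Step

-- the path from (0,0) to (n,m) of a nondecreasing x ∈ [n+1]^m:
-- exactly x_i - 1 letters E precede the i-th N.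
pathFrom : ℕ → ℕ → List ℕ → List Step
pathFrom n e []       = replicate (n ∸ e) E
pathFrom n e (a ∷ as) = replicate ((a ∸ 1) ∸ e) E ++ (N ∷ pathFrom n (a ∸ 1) as)

path : ℕ → List ℕ → List Step
path n x = pathFrom n 0 x

swapStep : Step → Step
swapStep N = E
swapStep E = N

conjPath : List Step → List Step
conjPath w = map swapStep (reverse w)

tupleFrom : ℕ → List Step → List ℕ
tupleFrom e []      = []
tupleFrom e (E ∷ w) = tupleFrom (suc e) w
tupleFrom e (N ∷ w) = suc e ∷ tupleFrom e w

tuple : List Step → List ℕ
tuple = tupleFrom 0

conj : ℕ → List ℕ → List ℕ
conj n x = tuple (conjPath (path n x))

-- For nondecreasing preferences every car parks in spot max(xᵢ, sᵢ₋₁ + 1), where sᵢ₋₁ is the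
-- spot of the previous car. Read the path w of x as a queue, an N being an arriving car and an
-- E a spot that serves one waiting car: the cars still waiting at the end are exactly those parked
-- beyond n, so the defect is the largest excess of N's over E's in a suffix of w. On the conjugate
-- path this becomes the largest excess of E's over N's in a prefix of w, and the two maxima differ
-- by the total excess m - n; inductively, queue(w) + n = m + queue(w̄). Conjugation of paths is an
-- involution and tuples correspond bijectively to paths, so conjugation of tuples is a bijection.
module Submission where

open import Defs
open import Data.Nat using (ℕ)
open import Data.Integer using (ℤ; +_; _+_; _-_)
open import Data.List using (List)
open import Data.Product using (_×_; Σ; ∃)
open import Relation.Binary.PropositionalEquality using (_≡_)

import Data.Nat as Nat
open Nat using (zero; suc; _∸_; _⊔_; _≤_; _<_; z≤n; s≤s; _≡ᵇ_; _<?_; _≤?_)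
open import Data.Nat.Properties
  using ( ≤-refl; ≤-trans; <⇒≤; ≤-pred; ≰⇒>; ≮⇒≥; ≤-antisym; <-≤-trans; m≤n⇒m≤1+n; n≤1+n
        ; n≤0⇒n≡0; +-comm; +-suc; +-identityʳ; +-cancelʳ-≡; +-monoˡ-≤; +-monoʳ-≤
        ; n∸n≡0; 0∸n≡0; m∸n≡0⇒m≤n; m≤n⇒m∸n≡0; ∸-+-assoc; +-∸-assoc; m∸n+n≡m; m+[n∸m]≡n
        ; m+n∸n≡m; m+n∸m≡n; m≤m+n; ∸-monoˡ-≤; ∸-distribʳ-⊔
        ; m≤m⊔n; m≤n⊔m; ⊔-sel; ⊔-lub; ⊔-pres-<m; >⇒≢; m<m+n; m≤n⇒m⊔n≡n; m≥n⇒m⊔n≡m)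
open import Data.Nat.ListAction using (sum)
open import Data.Nat.ListAction.Properties using (sum-++; sum-↭)
open import Data.Integer.Properties using (+-injective; pos-+)
open import Data.Integer.Tactic.RingSolver using (solve-∀)
open import Data.List using ([]; _∷_; length; filter; reverse; map; replicate; _++_; foldl; foldr)
open import Data.List.Properties
  using (++-identityʳ; map-++; reverse-map; reverse-involutive; map-∘; map-cong; map-id
        ; foldl-++; foldl-map; foldl-ʳ++; filter-accept; filter-reject)
open import Data.List.Relation.Binary.Permutation.Propositional.Properties using (↭-reverse)
open import Data.List.Relation.Unary.All using (All; []; _∷_)
import Data.List.Relation.Unary.All as All
open import Data.List.Relation.Unary.Linked using (Linked; [-]; _∷_)
import Data.List.Relation.Unary.Linked as Linked
open import Data.Bool using (Bool; true; false; _∨_)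
open import Data.Bool.ListAction using (any)
open import Data.Bool.Properties using (∨-zeroʳ)
open import Data.Product using (_,_; proj₁; proj₂)
open import Data.Sum using (inj₁; inj₂)
open import Function using (_∘_; id; _⇔_; mk⇔; Equivalence)
open import Relation.Nullary using (yes; no)
open import Relation.Nullary.Decidable using (dec-true; dec-false)
open import Relation.Binary.PropositionalEquality using (refl; sym; trans; cong; cong₂; subst; module ≡-Reasoning)

open ≡-Reasoning

[m∸o]∸[n∸o]≡m∸n : ∀ m {n o} → o ≤ n → (m ∸ o) ∸ (n ∸ o) ≡ m ∸ n
[m∸o]∸[n∸o]≡m∸n m {n} {o} o≤n = trans (∸-+-assoc m o (n ∸ o)) (cong (m ∸_) (m+[n∸m]≡n o≤n))

[n∸m]+[o∸n]≡o∸m : ∀ {m n o} → m ≤ n → n ≤ o → (n ∸ m) Nat.+ (o ∸ n) ≡ o ∸ m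
[n∸m]+[o∸n]≡o∸m {m} {n} {o} m≤n n≤o = begin
  (n ∸ m) Nat.+ (o ∸ n)   ≡⟨ +-comm (n ∸ m) (o ∸ n) ⟩
  (o ∸ n) Nat.+ (n ∸ m)   ≡⟨ +-∸-assoc (o ∸ n) m≤n ⟨
  ((o ∸ n) Nat.+ n) ∸ m   ≡⟨ cong (_∸ m) (m∸n+n≡m n≤o) ⟩
  o ∸ m                 ∎

[m⊔n]∸m≡n∸m : ∀ m n → (m ⊔ n) ∸ m ≡ n ∸ m
[m⊔n]∸m≡n∸m m n = trans (∸-distribʳ-⊔ m m n) (cong (_⊔ (n ∸ m)) (n∸n≡0 m))

Linked-weakenHead : ∀ {a b x} → a ≤ b → Linked _≤_ (b ∷ x) → Linked _≤_ (a ∷ x)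
Linked-weakenHead a≤b [-]         = [-]
Linked-weakenHead a≤b (b≤c ∷ lnk) = ≤-trans a≤b b≤c ∷ lnk

Linked⇒All≤ : ∀ {a x} → Linked _≤_ (a ∷ x) → All (a ≤_) x
Linked⇒All≤ [-]         = []
Linked⇒All≤ (a≤b ∷ lnk) = a≤b ∷ All.map (≤-trans a≤b) (Linked⇒All≤ lnk)

δ : Step → Step → ℕ
δ N N = 1
δ E E = 1
δ _ _ = 0

count : Step → List Step → ℕ
count s w = sum (map (δ s) w)

count-++ : ∀ s u v → count s (u ++ v) ≡ count s u Nat.+ count s v
count-++ s u v = trans (cong sum (map-++ (δ s) u v)) (sum-++ (map (δ s) u) (map (δ s) v))

count-reverse : ∀ s w → count s (reverse w) ≡ count s w
count-reverse s w = trans (cong sum (reverse-map (δ s) w)) (sum-↭ (↭-reverse (map (δ s) w)))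

δ-swap : ∀ s t → δ s (swapStep t) ≡ δ (swapStep s) t
δ-swap N N = refl
δ-swap N E = refl
δ-swap E N = refl
δ-swap E E = refl

count-map-swap : ∀ s w → count s (map swapStep w) ≡ count (swapStep s) w
count-map-swap s []      = refl
count-map-swap s (t ∷ w) = cong₂ Nat._+_ (δ-swap s t) (count-map-swap s w)

count-conjPath : ∀ s w → count s (conjPath w) ≡ count (swapStep s) w
count-conjPath s w = trans (count-map-swap s (reverse w)) (count-reverse (swapStep s) w)

count-E-replicate : ∀ k → count E (replicate k E) ≡ k
count-E-replicate zero    = refl
count-E-replicate (suc k) = cong suc (count-E-replicate k)

count-N-replicate : ∀ k → count N (replicate k E) ≡ 0
count-N-replicate zero    = refl
count-N-replicate (suc k) = count-N-replicate k

swapStep-involutive : ∀ s → swapStep (swapStep s) ≡ s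
swapStep-involutive N = refl
swapStep-involutive E = refl

conjPath-involutive : ∀ w → conjPath (conjPath w) ≡ w
conjPath-involutive w = begin
  map swapStep (reverse (map swapStep (reverse w)))  ≡⟨ reverse-map swapStep (map swapStep (reverse w)) ⟩
  reverse (map swapStep (map swapStep (reverse w)))  ≡⟨ cong reverse (map-∘ (reverse w)) ⟨
  reverse (map (swapStep ∘ swapStep) (reverse w))    ≡⟨ cong reverse (map-cong swapStep-involutive (reverse w)) ⟩
  reverse (map id (reverse w))                       ≡⟨ cong reverse (map-id (reverse w)) ⟩
  reverse (reverse w)                                ≡⟨ reverse-involutive w ⟩
  w                                                  ∎

record Path (m n : ℕ) (w : List Step) : Set where
  constructor _,_
  field
    count-N : count N w ≡ m
    count-E : count E w ≡ n

conjPath-Path : ∀ {m n w} → Path m n w → Path n m (conjPath w)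
conjPath-Path {w = w} (refl , refl) = count-conjPath N w , count-conjPath E w

SortedIn : ℕ → ℕ → List ℕ → Set
SortedIn e n x = Linked _≤_ (suc e ∷ x) × All (_≤ suc n) x

Tuple↑ : ℕ → ℕ → List ℕ → Set
Tuple↑ m n x = length x ≡ m × SortedIn 0 n x

DPF↑⇒Tuple↑ : ∀ {m n d x} → DPF↑ m n d x → Tuple↑ m n x
DPF↑⇒Tuple↑ {x = x} (len , inRange , sorted , _) = len , headed x inRange sorted , All.map proj₂ inRange
  where
  headed : ∀ {n} x → All (InRange n) x → Linked _≤_ x → Linked _≤_ (1 ∷ x)
  headed []      _                  _      = [-]
  headed (_ ∷ _) ((1≤a , _) ∷ _) sorted = 1≤a ∷ sorted

Tuple↑⇒DPF↑ : ∀ {m n d x} → Tuple↑ m n x → defect n x ≡ d → DPF↑ m n d x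
Tuple↑⇒DPF↑ (len , sorted , bounded) dx =
  len , All.zip (Linked⇒All≤ sorted , bounded) , Linked.tail sorted , dx

count-N-pathFrom : ∀ n e x → count N (pathFrom n e x) ≡ length x
count-N-pathFrom n e []       = count-N-replicate (n ∸ e)
count-N-pathFrom n e (a ∷ as) = begin
  count N (replicate ((a ∸ 1) ∸ e) E ++ N ∷ pathFrom n (a ∸ 1) as)
    ≡⟨ count-++ N (replicate ((a ∸ 1) ∸ e) E) _ ⟩
  count N (replicate ((a ∸ 1) ∸ e) E) Nat.+ suc (count N (pathFrom n (a ∸ 1) as))
    ≡⟨ cong₂ Nat._+_ (count-N-replicate ((a ∸ 1) ∸ e)) (cong suc (count-N-pathFrom n (a ∸ 1) as)) ⟩
  suc (length as) ∎

count-E-pathFrom : ∀ {n e x} → SortedIn e n x → count E (pathFrom n e x) ≡ n ∸ e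
count-E-pathFrom {n} {e} {[]}           _ = count-E-replicate (n ∸ e)
count-E-pathFrom {n} {e} {suc a ∷ as} (s≤s e≤a ∷ sorted , s≤s a≤n ∷ bounded) = begin
  count E (replicate (a ∸ e) E ++ N ∷ pathFrom n a as)         ≡⟨ count-++ E (replicate (a ∸ e) E) _ ⟩
  count E (replicate (a ∸ e) E) Nat.+ count E (pathFrom n a as)
    ≡⟨ cong₂ Nat._+_ (count-E-replicate (a ∸ e)) (count-E-pathFrom (sorted , bounded)) ⟩
  (a ∸ e) Nat.+ (n ∸ a)                                       ≡⟨ [n∸m]+[o∸n]≡o∸m e≤a a≤n ⟩
  n ∸ e                                                       ∎

tupleFrom-replicate : ∀ e k w → tupleFrom e (replicate k E ++ w) ≡ tupleFrom (k Nat.+ e) w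
tupleFrom-replicate e zero    w = refl
tupleFrom-replicate e (suc k) w =
  trans (tupleFrom-replicate (suc e) k w) (cong (λ e′ → tupleFrom e′ w) (+-suc k e))

tupleFrom-pathFrom : ∀ n {e x} → Linked _≤_ (suc e ∷ x) → tupleFrom e (pathFrom n e x) ≡ x
tupleFrom-pathFrom n {e} {[]} _ =
  trans (cong (tupleFrom e) (sym (++-identityʳ (replicate (n ∸ e) E)))) (tupleFrom-replicate e (n ∸ e) [])
tupleFrom-pathFrom n {e} {suc a ∷ as} (s≤s e≤a ∷ sorted) = begin
  tupleFrom e (replicate (a ∸ e) E ++ N ∷ pathFrom n a as)  ≡⟨ tupleFrom-replicate e (a ∸ e) _ ⟩
  tupleFrom ((a ∸ e) Nat.+ e) (N ∷ pathFrom n a as)          ≡⟨ cong (λ a′ → tupleFrom a′ (N ∷ pathFrom n a as)) (m∸n+n≡m e≤a) ⟩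
  suc a ∷ tupleFrom a (pathFrom n a as)                      ≡⟨ cong (suc a ∷_) (tupleFrom-pathFrom n sorted) ⟩
  suc a ∷ as                                                 ∎

pathFrom-suc : ∀ {n e x} → e < n → Linked _≤_ (suc (suc e) ∷ x) → pathFrom n e x ≡ E ∷ pathFrom n (suc e) x
pathFrom-suc {suc n} {e} {[]} (s≤s e≤n) _ = cong (λ k → replicate k E) (+-∸-assoc 1 e≤n)
pathFrom-suc {n} {e} {suc (suc a) ∷ as} _ (s≤s (s≤s e≤a) ∷ _) =
  cong (λ k → replicate k E ++ N ∷ pathFrom n (suc a) as) (+-∸-assoc 1 e≤a)

tupleFrom-sorted : ∀ e w → SortedIn e (e Nat.+ count E w) (tupleFrom e w)
tupleFrom-sorted e []      = [-] , []
tupleFrom-sorted e (N ∷ w) with tupleFrom-sorted e w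
... | sorted , bounded = ≤-refl ∷ sorted , s≤s (m≤m+n e (count E w)) ∷ bounded
tupleFrom-sorted e (E ∷ w) with tupleFrom-sorted (suc e) w
... | sorted , bounded =
  Linked-weakenHead (n≤1+n (suc e)) sorted ,
  subst (λ k → All (_≤ suc k) (tupleFrom (suc e) w)) (sym (+-suc e (count E w))) bounded

length-tupleFrom : ∀ e w → length (tupleFrom e w) ≡ count N w
length-tupleFrom e []      = refl
length-tupleFrom e (N ∷ w) = cong suc (length-tupleFrom e w)
length-tupleFrom e (E ∷ w) = length-tupleFrom (suc e) w

pathFrom-tupleFrom : ∀ e w → pathFrom (e Nat.+ count E w) e (tupleFrom e w) ≡ w
pathFrom-tupleFrom e []      = cong (λ k → replicate k E) (m+n∸m≡n e 0)
pathFrom-tupleFrom e (N ∷ w) =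
  trans (cong (λ k → replicate k E ++ N ∷ pathFrom (e Nat.+ count E w) e (tupleFrom e w)) (n∸n≡0 e))
        (cong (N ∷_) (pathFrom-tupleFrom e w))
pathFrom-tupleFrom e (E ∷ w) = begin
  pathFrom (e Nat.+ suc (count E w)) e t    ≡⟨ cong (λ n → pathFrom n e t) (+-suc e (count E w)) ⟩
  pathFrom (suc e Nat.+ count E w) e t
    ≡⟨ pathFrom-suc (s≤s (m≤m+n e (count E w))) (proj₁ (tupleFrom-sorted (suc e) w)) ⟩
  E ∷ pathFrom (suc e Nat.+ count E w) (suc e) t ≡⟨ cong (E ∷_) (pathFrom-tupleFrom (suc e) w) ⟩
  E ∷ w                                     ∎
  where t = tupleFrom (suc e) w

path-Path : ∀ {m n x} → Tuple↑ m n x → Path m n (path n x)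
path-Path {n = n} {x} (len , sorted) = trans (count-N-pathFrom n 0 x) len , count-E-pathFrom sorted

tuple-Tuple↑ : ∀ {m n w} → Path m n w → Tuple↑ m n (tuple w)
tuple-Tuple↑ {w = w} (refl , refl) = length-tupleFrom 0 w , tupleFrom-sorted 0 w

tuple-path : ∀ {m n x} → Tuple↑ m n x → tuple (path n x) ≡ x
tuple-path {n = n} (_ , sorted , _) = tupleFrom-pathFrom n sorted

path-tuple : ∀ {n w} → count E w ≡ n → path n (tuple w) ≡ w
path-tuple {w = w} refl = pathFrom-tupleFrom 0 w

conj-Tuple↑ : ∀ {m n x} → Tuple↑ m n x → Tuple↑ n m (conj n x)
conj-Tuple↑ t = tuple-Tuple↑ (conjPath-Path (path-Path t))

path-conj : ∀ {m n x} → Tuple↑ m n x → path m (conj n x) ≡ conjPath (path n x)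
path-conj t = path-tuple (Path.count-E (conjPath-Path (path-Path t)))

conj-involutive : ∀ {m n x} → Tuple↑ m n x → conj m (conj n x) ≡ x
conj-involutive {m} {n} {x} t = begin
  tuple (conjPath (path m (conj n x)))     ≡⟨ cong (tuple ∘ conjPath) (path-conj t) ⟩
  tuple (conjPath (conjPath (path n x)))   ≡⟨ cong tuple (conjPath-involutive (path n x)) ⟩
  tuple (path n x)                         ≡⟨ tuple-path t ⟩
  x                                        ∎

queueStep : ℕ → Step → ℕ
queueStep q N = suc q
queueStep q E = q ∸ 1

queue : ℕ → List Step → ℕ
queue = foldl queueStep

queueʳ : ℕ → List Step → ℕ
queueʳ = foldr (λ s q → queueStep q (swapStep s))

queue-conjPath : ∀ q w → queue q (conjPath w) ≡ queueʳ q w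
queue-conjPath q w = trans (foldl-map queueStep swapStep q (reverse w)) (foldl-ʳ++ _ q w)

queue-replicate : ∀ q k → queue q (replicate k E) ≡ q ∸ k
queue-replicate q zero    = refl
queue-replicate q (suc k) = trans (queue-replicate (q ∸ 1) k) (∸-+-assoc q 1 k)

queue-balance : ∀ q w → queue q w Nat.+ count E w ≡ q Nat.+ count N w Nat.+ (queueʳ 0 w ∸ q)
queue-balance q []      = sym (trans (cong (q Nat.+ 0 Nat.+_) (0∸n≡0 q)) (+-identityʳ (q Nat.+ 0)))
queue-balance q (N ∷ w) = trans (queue-balance (suc q) w)
  (cong₂ Nat._+_ (sym (+-suc q (count N w))) (sym (∸-+-assoc (queueʳ 0 w) 1 q)))
queue-balance zero (E ∷ w) =
  trans (+-suc (queue 0 w) (count E w)) (trans (cong suc (queue-balance 0 w)) (sym (+-suc (count N w) (queueʳ 0 w))))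
queue-balance (suc q) (E ∷ w) = trans (+-suc (queue q w) (count E w)) (cong suc (queue-balance q w))

occupied : List ℕ → ℕ → Bool
occupied occ j = any (λ b → j ≡ᵇ b) occ

-- The state after parking a nondecreasing sequence whose last preference is L and whose last car
-- took spot p; `few` makes the fuel of firstFree suffice to run through the block [L, p].
record Parked (occ : List ℕ) (L p : ℕ) : Set where
  field
    filled : ∀ {j} → L ≤ j → j ≤ p → occupied occ j ≡ true
    vacant : ∀ {j} → p < j → occupied occ j ≡ false
    few    : p < L Nat.+ length occ

firstFreeFuel-skip : ∀ {occ p} f a → (∀ {j} → a ≤ j → j ≤ p → occupied occ j ≡ true) →
  (∀ {j} → p < j → occupied occ j ≡ false) → suc p ∸ a ≤ f → firstFreeFuel occ a f ≡ a ⊔ suc p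
firstFreeFuel-skip zero a _ _ fuel = sym (m≥n⇒m⊔n≡m (m∸n≡0⇒m≤n (n≤0⇒n≡0 fuel)))
firstFreeFuel-skip {occ} {p} (suc f) a filled vacant fuel with a ≤? p
... | yes a≤p rewrite filled ≤-refl a≤p = begin
  firstFreeFuel occ (suc a) f  ≡⟨ firstFreeFuel-skip f (suc a) (filled ∘ <⇒≤) vacant fuel′ ⟩
  suc a ⊔ suc p                ≡⟨ m≤n⇒m⊔n≡n (s≤s a≤p) ⟩
  suc p                        ≡⟨ m≤n⇒m⊔n≡n (m≤n⇒m≤1+n a≤p) ⟨
  a ⊔ suc p                    ∎
  where fuel′ = ≤-pred (subst (_≤ suc f) (+-∸-assoc 1 a≤p) fuel)
... | no a≰p rewrite vacant (≰⇒> a≰p) = sym (m≥n⇒m⊔n≡m (≰⇒> a≰p))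

Parked-[] : Parked [] 1 0
Parked-[] = record { filled = λ { (s≤s _) () } ; vacant = λ _ → refl ; few = s≤s z≤n }

module _ {occ L p} (parked : Parked occ L p) {a} (L≤a : L ≤ a) where
  open Parked parked

  firstFree-Parked : firstFree occ a ≡ a ⊔ suc p
  firstFree-Parked = firstFreeFuel-skip (suc (length occ)) a (filled ∘ ≤-trans L≤a) vacant fuel
    where
    fuel : suc p ∸ a ≤ suc (length occ)
    fuel = subst (suc p ∸ a ≤_) (m+n∸m≡n a _)
             (∸-monoˡ-≤ a (≤-trans few (≤-trans (+-monoˡ-≤ _ L≤a) (+-monoʳ-≤ a (n≤1+n (length occ))))))

  Parked-∷ : Parked ((a ⊔ suc p) ∷ occ) a (a ⊔ suc p)
  Parked-∷ = record { filled = filled′ ; vacant = vacant′ ; few = few′ }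
    where
    s = a ⊔ suc p

    filled′ : ∀ {j} → a ≤ j → j ≤ s → occupied (s ∷ occ) j ≡ true
    filled′ {j} a≤j j≤s with j ≤? p
    ... | yes j≤p = trans (cong ((j ≡ᵇ s) ∨_) (filled (≤-trans L≤a a≤j) j≤p)) (∨-zeroʳ (j ≡ᵇ s))
    ... | no  j≰p with ≤-antisym j≤s (⊔-lub a≤j (≰⇒> j≰p))
    ...   | refl = cong (_∨ occupied occ j) (dec-true (j Nat.≟ j) refl)

    vacant′ : ∀ {j} → s < j → occupied (s ∷ occ) j ≡ false
    vacant′ {j} s<j rewrite dec-false (j Nat.≟ s) (>⇒≢ s<j) = vacant (<-≤-trans (m≤n⊔m a (suc p)) (<⇒≤ s<j))

    few′ : s < a Nat.+ suc (length occ)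
    few′ = ⊔-pres-<m (m<m+n a (s≤s z≤n))
             (subst (suc p <_) (sym (+-suc a (length occ))) (s≤s (≤-trans few (+-monoˡ-≤ (length occ) L≤a))))

spotsAfter : ℕ → List ℕ → List ℕ
spotsAfter p []       = []
spotsAfter p (a ∷ as) = (a ⊔ suc p) ∷ spotsAfter (a ⊔ suc p) as

spotsFrom-Parked : ∀ {occ L p x} → Parked occ L p → Linked _≤_ (L ∷ x) → spotsFrom occ x ≡ spotsAfter p x
spotsFrom-Parked {x = []}    _      _              = refl
spotsFrom-Parked {x = a ∷ _} parked (L≤a ∷ sorted) rewrite firstFree-Parked parked L≤a =
  cong (a ⊔ suc _ ∷_) (spotsFrom-Parked (Parked-∷ parked L≤a) sorted)

beyond : ℕ → List ℕ → ℕ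
beyond n l = length (filter (n <?_) l)

beyond-∷ : ∀ n p a l → a ≤ suc n → beyond n ((a ⊔ suc p) ∷ l) Nat.+ (p ∸ n) ≡ beyond n l Nat.+ ((a ⊔ suc p) ∸ n)
beyond-∷ n p a l a≤1+n with n <? a ⊔ suc p
... | yes n<s = trans (cong (λ k → length k Nat.+ (p ∸ n)) (filter-accept (n <?_) n<s))
                      (trans (sym (+-suc _ (p ∸ n))) (cong (beyond n l Nat.+_) (overflow n<s)))
  where
  overflow : n < a ⊔ suc p → suc (p ∸ n) ≡ (a ⊔ suc p) ∸ n
  overflow n<s with ⊔-sel a (suc p)
  ... | inj₂ s≡1+p = trans (sym (+-∸-assoc 1 (≤-pred (subst (n <_) s≡1+p n<s)))) (cong (_∸ n) (sym s≡1+p))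
  ... | inj₁ s≡a = begin
    suc (p ∸ n)       ≡⟨ cong suc (m≤n⇒m∸n≡0 p≤n) ⟩
    1                 ≡⟨ m+n∸n≡m 1 n ⟨
    suc n ∸ n         ≡⟨ cong (_∸ n) (trans s≡a a≡1+n) ⟨
    (a ⊔ suc p) ∸ n   ∎
    where
    a≡1+n = ≤-antisym a≤1+n (subst (n <_) s≡a n<s)
    p≤n   = ≤-pred (subst (suc p ≤_) (trans s≡a a≡1+n) (m≤n⊔m a (suc p)))
... | no n≮s =
  cong₂ Nat._+_ (cong length (filter-reject (n <?_) n≮s)) (trans (m≤n⇒m∸n≡0 p≤n) (sym (m≤n⇒m∸n≡0 s≤n)))
  where
  s≤n = ≮⇒≥ n≮s
  p≤n = <⇒≤ (<-≤-trans (m≤n⊔m a (suc p)) s≤n)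

-- With the street read up to spot e and the last car in spot p, the queue holds the p ∸ e cars in
-- spots e + 1, …, p.
queue-spotsAfter : ∀ {n e x} p → e ≤ n → SortedIn e n x →
  beyond n (spotsAfter p x) Nat.+ (p ∸ n) ≡ queue (p ∸ e) (pathFrom n e x)
queue-spotsAfter {n} {e} {[]} p e≤n _ = sym (begin
  queue (p ∸ e) (replicate (n ∸ e) E)  ≡⟨ queue-replicate (p ∸ e) (n ∸ e) ⟩
  (p ∸ e) ∸ (n ∸ e)                    ≡⟨ [m∸o]∸[n∸o]≡m∸n p e≤n ⟩
  p ∸ n                                ∎)
queue-spotsAfter {n} {e} {suc a ∷ as} p _ (s≤s e≤a ∷ sorted , s≤s a≤n ∷ bounded) = begin
  beyond n (s ∷ spotsAfter s as) Nat.+ (p ∸ n)  ≡⟨ beyond-∷ n p (suc a) (spotsAfter s as) (s≤s a≤n) ⟩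
  beyond n (spotsAfter s as) Nat.+ (s ∸ n)      ≡⟨ queue-spotsAfter s a≤n (sorted , bounded) ⟩
  queue (s ∸ a) rest                            ≡⟨ cong (λ q → queue q rest) s∸a ⟩
  queue (suc (queue (p ∸ e) (replicate (a ∸ e) E))) rest
    ≡⟨ foldl-++ queueStep (p ∸ e) (replicate (a ∸ e) E) (N ∷ rest) ⟨
  queue (p ∸ e) (replicate (a ∸ e) E ++ N ∷ rest) ∎
  where
  s    = suc a ⊔ suc p
  rest = pathFrom n a as
  s∸a : s ∸ a ≡ suc (queue (p ∸ e) (replicate (a ∸ e) E))
  s∸a = begin
    suc (a ⊔ p) ∸ a                            ≡⟨ +-∸-assoc 1 (m≤m⊔n a p) ⟩
    suc ((a ⊔ p) ∸ a)                          ≡⟨ cong suc ([m⊔n]∸m≡n∸m a p) ⟩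
    suc (p ∸ a)                                ≡⟨ cong suc ([m∸o]∸[n∸o]≡m∸n p e≤a) ⟨
    suc ((p ∸ e) ∸ (a ∸ e))                    ≡⟨ cong suc (queue-replicate (p ∸ e) (a ∸ e)) ⟨
    suc (queue (p ∸ e) (replicate (a ∸ e) E))  ∎

defect≡queue : ∀ {n x} → SortedIn 0 n x → defect n x ≡ queue 0 (path n x)
defect≡queue {n} {x} sorted = begin
  beyond n (spots x)                     ≡⟨ cong (beyond n) (spotsFrom-Parked Parked-[] (proj₁ sorted)) ⟩
  beyond n (spotsAfter 0 x)              ≡⟨ +-identityʳ _ ⟨
  beyond n (spotsAfter 0 x) Nat.+ 0      ≡⟨ cong (beyond n (spotsAfter 0 x) Nat.+_) (0∸n≡0 n) ⟨
  beyond n (spotsAfter 0 x) Nat.+ (0 ∸ n) ≡⟨ queue-spotsAfter 0 z≤n sorted ⟩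
  queue 0 (path n x)                     ∎

defect-conj : ∀ {m n x} → Tuple↑ m n x → defect m (conj n x) Nat.+ m ≡ defect n x Nat.+ n
defect-conj {m} {n} {x} t = begin
  defect m (conj n x) Nat.+ m              ≡⟨ +-comm _ m ⟩
  m Nat.+ defect m (conj n x)              ≡⟨ cong (m Nat.+_) (defect≡queue (proj₂ (conj-Tuple↑ t))) ⟩
  m Nat.+ queue 0 (path m (conj n x))      ≡⟨ cong (λ v → m Nat.+ queue 0 v) (path-conj t) ⟩
  m Nat.+ queue 0 (conjPath w)             ≡⟨ cong₂ Nat._+_ count-N (sym (queue-conjPath 0 w)) ⟨
  count N w Nat.+ queueʳ 0 w               ≡⟨ queue-balance 0 w ⟨
  queue 0 w Nat.+ count E w                ≡⟨ cong₂ Nat._+_ (defect≡queue (proj₂ t)) (sym count-E) ⟨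
  defect n x Nat.+ n                       ∎
  where
  w = path n x
  open Path (path-Path t)

conj-DPF↑ : ∀ {m n d e x} → DPF↑ m n d x → e Nat.+ m ≡ d Nat.+ n → DPF↑ n m e (conj n x)
conj-DPF↑ {m} {e = e} dpf@(_ , _ , _ , refl) e+m≡d+n =
  Tuple↑⇒DPF↑ (conj-Tuple↑ t) (+-cancelʳ-≡ m _ e (trans (defect-conj t) (sym e+m≡d+n)))
  where t = DPF↑⇒Tuple↑ dpf

+e≡+d+[+n-+m]⇔e+m≡d+n : ∀ d e m n → (+ e ≡ + d + (+ n - + m)) ⇔ (e Nat.+ m ≡ d Nat.+ n)
+e≡+d+[+n-+m]⇔e+m≡d+n d e m n = mk⇔ to from
  where
  cancel : ∀ i j k → i + (j - k) + k ≡ i + j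
  cancel = solve-∀
  uncancel : ∀ i k → i ≡ i + k - k
  uncancel = solve-∀
  regroup : ∀ i j k → i + j - k ≡ i + (j - k)
  regroup = solve-∀

  to : + e ≡ + d + (+ n - + m) → e Nat.+ m ≡ d Nat.+ n
  to h = +-injective (begin
    + (e Nat.+ m)             ≡⟨ pos-+ e m ⟩
    + e + + m                 ≡⟨ cong (_+ + m) h ⟩
    + d + (+ n - + m) + + m   ≡⟨ cancel (+ d) (+ n) (+ m) ⟩
    + d + + n                 ≡⟨ pos-+ d n ⟨
    + (d Nat.+ n)             ∎)

  from : e Nat.+ m ≡ d Nat.+ n → + e ≡ + d + (+ n - + m)
  from h = begin
    + e                  ≡⟨ uncancel (+ e) (+ m) ⟩
    + e + + m - + m      ≡⟨ cong (_- + m) (pos-+ e m) ⟨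
    + (e Nat.+ m) - + m  ≡⟨ cong (λ k → + k - + m) h ⟩
    + (d Nat.+ n) - + m  ≡⟨ cong (_- + m) (pos-+ d n) ⟩
    + d + + n - + m      ≡⟨ regroup (+ d) (+ n) (+ m) ⟩
    + d + (+ n - + m)    ∎

proposition4p19 : (m n d : ℕ) →
    ((x : List ℕ) → DPF↑ m n d x →
      Σ ℕ (λ e → + e ≡ + d + (+ n - + m) × DPF↑ n m e (conj n x)))
    × ((x y : List ℕ) → DPF↑ m n d x → DPF↑ m n d y → conj n x ≡ conj n y → x ≡ y)
    × ((e : ℕ) → + e ≡ + d + (+ n - + m) → (y : List ℕ) → DPF↑ n m e y →
      ∃ (λ x → DPF↑ m n d x × conj n x ≡ y))
proposition4p19 m n d = maps-to , injective , surjective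
  where
  shift = λ e → +e≡+d+[+n-+m]⇔e+m≡d+n d e m n

  maps-to : (x : List ℕ) → DPF↑ m n d x → Σ ℕ (λ e → + e ≡ + d + (+ n - + m) × DPF↑ n m e (conj n x))
  maps-to x dpf@(_ , _ , _ , refl) =
    defect m (conj n x) , Equivalence.from (shift _) e+m≡d+n , conj-DPF↑ dpf e+m≡d+n
    where e+m≡d+n = defect-conj (DPF↑⇒Tuple↑ dpf)

  injective : (x y : List ℕ) → DPF↑ m n d x → DPF↑ m n d y → conj n x ≡ conj n y → x ≡ y
  injective x y dx dy eq = begin
    x                   ≡⟨ conj-involutive (DPF↑⇒Tuple↑ dx) ⟨
    conj m (conj n x)   ≡⟨ cong (conj m) eq ⟩
    conj m (conj n y)   ≡⟨ conj-involutive (DPF↑⇒Tuple↑ dy) ⟩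
    y                   ∎

  surjective : (e : ℕ) → + e ≡ + d + (+ n - + m) → (y : List ℕ) → DPF↑ n m e y →
    ∃ (λ x → DPF↑ m n d x × conj n x ≡ y)
  surjective e he y dpf =
    conj m y , conj-DPF↑ dpf (sym (Equivalence.to (shift e) he)) , conj-involutive (DPF↑⇒Tuple↑ dpf)
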